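{- If $C$ is a caterpillar of order $n$, then $\alpha_{bn}(C)\le n-|B_C|+\alpha(C[R_C])$.
   Context: A caterpillar is a tree with a diametrical path such that every vertex lies on that path or is adjacent to a vertex on it. For a tree $T$: $B_T$ is the set of branch vertices (degree at least 3), $L_T$ the set of leaves, $\tau_T$ the set of vertices of degree 2 (trunks). The branch-leaf representation $\mathcal{BL}(T)$ is obtained from $T$ by repeatedly deleting a vertex of degree 2 and joining its two neighbours by an edge until no vertex of degree 2 remains. $R_T\subseteq B_T$ is the set of branch vertices that are adjacent to at most one leaf in $\mathcal{BL}(T)$ (equivalently, $b\in B_T$ is in $R_T$ iff there is at most one leaf $l\in L_T$ such that for every $b'\in B_T\setminus\{b\}$ the unique $b'$–$l$ path contains $b$). $T[R_T]$ is the subgraph induced by $R_T$ and $\alpha(\cdot)$ denotes independence number (taken as $0$ for the empty graph). A broadcast on a connected graph $G$ is a function $f:V(G)\to\{0,1,\dots,\operatorname{diam}(G)\}$ with $f(v)\le e(v)$ (the eccentricity of $v$). Let $V_f^+=\{v: f(v)>0\}$. A vertex $u$ hears $f$ from $v\in V_f^+$ if $d_G(u,v)\le f(v)$; $N_f(v)$ is the set of vertices hearing $f$ from $v$ (including $v$), $PN_f(v)$ the set of vertices hearing $f$ only from $v$, and $B_f(v)=\{u\in N_f(v): d_G(u,v)=f(v)\}$. The broadcast $f$ is boundary independent if $N_f(v)\setminus B_f(v)\subseteq PN_f(v)$ for all $v\in V_f^+$. The cost is $\sigma(f)=\sum_v f(v)$, and $\alpha_{bn}(G)$ is the maximum cost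 of a boundary independent broadcast on $G$. -}

module Defs where

open import Data.Nat using (ℕ; zero; suc; _+_; _∸_; _≤_; _<_; _≤?_)
open import Data.Fin using (Fin)
open import Data.Bool using (Bool; true; false; if_then_else_; T)
open import Data.List using (List; []; _∷_; length; map; filter; allFin)
open import Data.Nat.ListAction using (sum)
open import Data.List.Membership.Propositional using (_∈_)
open import Data.List.Relation.Unary.Unique.Propositional using (Unique)
open import Data.Product using (Σ; ∃; ∃-syntax; _×_; _,_)
open import Data.Sum using (_⊎_)
open import Relation.Nullary using (¬_)
open import Relation.Binary.PropositionalEquality using (_≡_; _≢_)

record Graph (n : ℕ) : Set where
  field
    adj    : Fin n → Fin n → Bool
    sym    : ∀ u v → adj u v ≡ adj v u
    irrefl : ∀ u → adj u u ≡ false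
open Graph public

module _ {n : ℕ} (G : Graph n) where

  Adj : Fin n → Fin n → Set
  Adj u v = T (adj G u v)

  data Walk : Fin n → Fin n → ℕ → Set where
    here : ∀ {u} → Walk u u 0
    step : ∀ {u w v k} → Adj u w → Walk w v k → Walk u v (suc k)

  DistLe : Fin n → Fin n → ℕ → Set
  DistLe u v k = ∃[ d ] (d ≤ k × Walk u v d)

  Dist : Fin n → Fin n → ℕ → Set
  Dist u v d = Walk u v d × (∀ k → Walk u v k → d ≤ k)

  Connected : Set
  Connected = ∀ u v → ∃[ k ] Walk u v k

  data PathFrom : Fin n → Fin n → List (Fin n) → Set where
    single : ∀ {u} → PathFrom u u (u ∷ [])
    cons   : ∀ {u w v xs} → Adj u w → PathFrom w v xs → PathFrom u v (u ∷ xs)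

  IsPath : Fin n → Fin n → List (Fin n) → Set
  IsPath u v xs = PathFrom u v xs × Unique xs

  HasCycle : Set
  HasCycle = ∃[ u ] ∃[ v ] ∃[ xs ] (IsPath u v xs × 3 ≤ length xs × Adj v u)

  IsTree : Set
  IsTree = Connected × ¬ HasCycle

  IsDiam : ℕ → Set
  IsDiam D = (∀ x y d → Dist x y d → d ≤ D) × (∃[ x ] ∃[ y ] Dist x y D)

  IsEcc : Fin n → ℕ → Set
  IsEcc v e = (∀ u d → Dist v u d → d ≤ e) × (∃[ u ] Dist v u e)

  IsCaterpillar : Set
  IsCaterpillar =
    IsTree ×
    (∃[ u ] ∃[ v ] ∃[ xs ]
      (IsPath u v xs × Dist u v (length xs ∸ 1) × IsDiam (length xs ∸ 1) ×
       (∀ x → x ∈ xs ⊎ (∃[ y ] (y ∈ xs × Adj x y)))))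

  deg : Fin n → ℕ
  deg v = sum (map (λ u → if adj G v u then 1 else 0) (allFin n))

  IsLeaf : Fin n → Set
  IsLeaf v = deg v ≡ 1

  IsBranch : Fin n → Set
  IsBranch v = 3 ≤ deg v

  branchCount : ℕ
  branchCount = length (filter (λ v → 3 ≤? deg v) (allFin n))

  Separates : Fin n → Fin n → Set
  Separates b l = ∀ b' → IsBranch b' → b' ≢ b → ∀ xs → IsPath b' l xs → b ∈ xs

  InR : Fin n → Set
  InR b = IsBranch b ×
          (∀ l l' → IsLeaf l → IsLeaf l' → Separates b l → Separates b l' → l ≡ l')

  IndepInR : List (Fin n) → Set
  IndepInR S = Unique S × (∀ x → x ∈ S → InR x) × (∀ x y → x ∈ S → y ∈ S → ¬ Adj x y)

  -- α(G[R_G]) = a   (a = 0 when R_G is empty, witnessed by S = [])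
  IsAlphaR : ℕ → Set
  IsAlphaR a = (∃[ S ] (IndepInR S × length S ≡ a)) ×
               (∀ S → IndepInR S → length S ≤ a)

  -- broadcast: f(v) ≤ e(v) for all v (this also gives f(v) ≤ diam(G))
  IsBroadcast : (Fin n → ℕ) → Set
  IsBroadcast f = ∀ v e → IsEcc v e → f v ≤ e

  Hears : (Fin n → ℕ) → Fin n → Fin n → Set
  Hears f u v = 0 < f v × DistLe v u (f v)

  InBoundary : (Fin n → ℕ) → Fin n → Fin n → Set
  InBoundary f u v = Hears f u v × Dist v u (f v)

  InPN : (Fin n → ℕ) → Fin n → Fin n → Set
  InPN f u v = Hears f u v × (∀ w → Hears f u w → w ≡ v)

  BoundaryIndependent : (Fin n → ℕ) → Set
  BoundaryIndependent f =
    ∀ v → 0 < f v → ∀ u → Hears f u v → ¬ InBoundary f u v → InPN f u v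

  cost : (Fin n → ℕ) → ℕ
  cost f = sum (map f (allFin n))

module Submission where

-- Fix a diametrical path p₀ … p_{L-1}: every other vertex is a leaf hanging from it, so every branch
-- vertex lies on it. For each v, the first f(v) vertices of a longest geodesic from v lie strictly
-- inside the ball of v, and boundary independence makes such vertices hear v alone; over all v they
-- form a set K of cost(f) distinct vertices. Each branch vertex b is charged injectively to a vertex
-- outside K: b itself if it lies strictly inside no ball; otherwise, with v the broadcaster whose
-- ball has b in its interior, a leaf at b other than v, or a spine neighbour of b chosen by whether
-- f(v) ≥ 3 and by where the other branch vertices lie. The branch vertices left uncharged have a
-- single leaf v with f(v) = 2 and branch vertices on both sides; they lie in R and are pairwise
-- non-adjacent, so there are at most α(C[R]) of them, and cost(f) + |B| − α(C[R]) ≤ n.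

open import Defs hiding (sym)
open import Data.Bool using (true; false; if_then_else_; T)
open import Data.Empty using (⊥; ⊥-elim)
open import Data.Unit using (tt)
open import Data.Fin using (Fin) renaming (zero to fzero; suc to fsuc)
open import Data.Fin.Properties using (any?; injective⇒≤) renaming (_≟_ to _≟ᶠ_)
open import Data.List
  using (List; []; _∷_; [_]; length; map; allFin; _++_; applyUpTo; applyDownFrom; concatMap; lookup)
open import Data.List.Extrema.Nat using (argmax; f[xs]≤f[argmax])
open import Data.List.Membership.Propositional using (_∈_; _∉_; find)
open import Data.List.Membership.Propositional.Properties
  using (∈-allFin; ∈-lookup; ∈-++⁻; ∈-concatMap⁻; ∈-applyUpTo⁻; ∈-applyDownFrom⁻)
open import Data.List.Properties using (length-++; length-applyUpTo; map-cong)
open import Data.List.Relation.Unary.All using (All; []; _∷_) renaming (lookup to All-lookup; map to All-map)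
open import Data.List.Relation.Unary.All.Properties using (all-filter; All¬⇒¬Any; ¬Any⇒All¬)
open import Data.List.Relation.Unary.Any using (here; there)
open import Data.List.Relation.Unary.AllPairs using ([]; _∷_)
open import Data.List.Relation.Unary.Unique.Propositional using (Unique)
open import Data.List.Relation.Unary.Unique.Propositional.Properties
  using (allFin⁺; filter⁺; ++⁺; applyUpTo⁺₁; applyDownFrom⁺₁)
open import Data.Nat using (ℕ; zero; suc; _+_; _∸_; _≤_; _<_; _≤?_; z≤n; s≤s; s≤s⁻¹; z<s; _<?_)
open import Data.Nat.Induction using (<-rec)
open import Data.Nat.ListAction using (sum)
open import Data.Nat.Properties
open import Algebra.Properties.CommutativeSemigroup +-commutativeSemigroup
  using () renaming (interchange to +-interchange)
open import Data.Product using (∃; ∃-syntax; _×_; _,_; proj₁; proj₂)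
open import Data.Sum using (_⊎_; inj₁; inj₂)
open import Function using (_∘_)
open import Relation.Binary.Definitions using (tri<; tri≈; tri>)
open import Relation.Binary.PropositionalEquality
  using (_≡_; _≢_; refl; sym; trans; cong; subst; subst₂)
open import Relation.Nullary using (¬_; Dec; yes; no; ¬?; does)
open import Relation.Nullary.Decidable using (_×-dec_; T?; decidable-stable)
open import Relation.Unary using (Decidable)

Least : (ℕ → Set) → Set
Least P = ∃[ d ] (P d × (∀ {j} → j < d → ¬ P j))

least-witness : {P : ℕ → Set} → Decidable P → ∀ k → P k → Least P
least-witness {P} P? = <-rec (λ k → P k → Least P) search
  where
  search : ∀ k → (∀ {j} → j < k → P j → Least P) → P k → Least P
  search k smaller pk with anyUpTo? P? k
  ... | yes (j , j<k , pj) = smaller j<k pj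
  ... | no none = k , pk , λ j<k pj → none (_ , j<k , pj)

Between : ℕ → ℕ → ℕ → Set
Between i j t = (i ≤ t × t ≤ j) ⊎ (j ≤ t × t ≤ i)

Between⇒< : ∀ {i j t u} → Between i j t → i < u → j < u → t < u
Between⇒< (inj₁ (_ , t≤j)) _ j<u = ≤-<-trans t≤j j<u
Between⇒< (inj₂ (_ , t≤i)) i<u _ = ≤-<-trans t≤i i<u

Between⇒> : ∀ {i j t u} → Between i j t → u < i → u < j → u < t
Between⇒> (inj₁ (i≤t , _)) u<i _ = <-≤-trans u<i i≤t
Between⇒> (inj₂ (j≤t , _)) _ u<j = <-≤-trans u<j j≤t

lookup-injective : ∀ {A : Set} {xs : List A} → Unique xs →
                   ∀ {i j} → lookup xs i ≡ lookup xs j → i ≡ j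
lookup-injective {xs = x ∷ xs} (x∉xs ∷ u) {fzero}  {fzero}  _ = refl
lookup-injective {xs = x ∷ xs} (x∉xs ∷ u) {fzero}  {fsuc j} e =
  ⊥-elim (All¬⇒¬Any x∉xs (subst (_∈ xs) (sym e) (∈-lookup j)))
lookup-injective {xs = x ∷ xs} (x∉xs ∷ u) {fsuc i} {fzero}  e =
  ⊥-elim (All¬⇒¬Any x∉xs (subst (_∈ xs) e (∈-lookup i)))
lookup-injective {xs = x ∷ xs} (x∉xs ∷ u) {fsuc i} {fsuc j} e = cong fsuc (lookup-injective u e)

Unique-length≤ : ∀ {n} {xs : List (Fin n)} → Unique xs → length xs ≤ n
Unique-length≤ u = injective⇒≤ (lookup-injective u)

module _ {A B : Set} (g : A → List B) where

  length-concatMap : ∀ xs → length (concatMap g xs) ≡ sum (map (length ∘ g) xs)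
  length-concatMap []       = refl
  length-concatMap (x ∷ xs) = trans (length-++ (g x)) (cong (length (g x) +_) (length-concatMap xs))

  concatMap⁺ : ∀ {xs} → Unique xs → (∀ x → Unique (g x)) →
               (∀ {x x' y} → y ∈ g x → y ∈ g x' → x ≡ x') → Unique (concatMap g xs)
  concatMap⁺ {[]}     []          _      _     = []
  concatMap⁺ {x ∷ xs} (x∉xs ∷ u) unique apart = ++⁺ (unique x) (concatMap⁺ u unique apart) disjoint
    where
    disjoint : ∀ {y} → ¬ (y ∈ g x × y ∈ concatMap g xs)
    disjoint (y∈gx , y∈rest) with find (∈-concatMap⁻ g y∈rest)
    ... | x' , x'∈xs , y∈gx' with apart y∈gx y∈gx'
    ...   | refl = All¬⇒¬Any x∉xs x'∈xs

sum-map-mono : ∀ {A : Set} {g h : A → ℕ} → (∀ x → g x ≤ h x) →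
               ∀ xs → sum (map g xs) ≤ sum (map h xs)
sum-map-mono g≤h []       = z≤n
sum-map-mono g≤h (x ∷ xs) = +-mono-≤ (g≤h x) (sum-map-mono g≤h xs)

sum-map-+ : ∀ {A : Set} (g h : A → ℕ) xs → sum (map (λ x → g x + h x) xs) ≡ sum (map g xs) + sum (map h xs)
sum-map-+ g h []       = refl
sum-map-+ g h (x ∷ xs) =
  trans (cong (g x + h x +_) (sum-map-+ g h xs)) (+-interchange (g x) (h x) (sum (map g xs)) (sum (map h xs)))

module _ {m : ℕ} where

  ⟦_≡_⟧ : Fin m → Fin m → ℕ
  ⟦ u ≡ a ⟧ = if does (u ≟ᶠ a) then 1 else 0

  1≤⟦a≡a⟧ : ∀ a → 1 ≤ ⟦ a ≡ a ⟧
  1≤⟦a≡a⟧ a with a ≟ᶠ a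
  ... | yes _   = ≤-refl
  ... | no  a≢a = ⊥-elim (a≢a refl)

  occurrences≤1 : ∀ a {xs : List (Fin m)} → Unique xs → sum (map ⟦_≡ a ⟧ xs) ≤ 1
  occurrences≤1 a {[]}     []          = z≤n
  occurrences≤1 a {x ∷ xs} (x∉xs ∷ u) with x ≟ᶠ a
  ... | no  _    = occurrences≤1 a u
  ... | yes refl = s≤s (≤-reflexive (absent xs x∉xs))
    where
    absent : ∀ ys → All (a ≢_) ys → sum (map ⟦_≡ a ⟧ ys) ≡ 0
    absent []       []            = refl
    absent (y ∷ ys) (a≢y ∷ a∉ys) with y ≟ᶠ a
    ... | yes y≡a = ⊥-elim (a≢y (sym y≡a))
    ... | no  _   = absent ys a∉ys

module _ {A B : Set} (Witness : A → B → Set) (Special : A → Set)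
         (Witness-injective : ∀ {a a' y} → Witness a y → Witness a' y → a ≡ a') where

  record Partition (as : List A) : Set where
    field
      witnesses        : List B
      specials         : List A
      length-partition : length witnesses + length specials ≡ length as
      witnessing       : ∀ {y} → y ∈ witnesses → ∃[ a ] (a ∈ as × Witness a y)
      special          : ∀ {a} → a ∈ specials → a ∈ as × Special a
      witnesses-unique : Unique witnesses
      specials-unique  : Unique specials

  partition : ∀ {as} → Unique as → All (λ a → ∃ (Witness a) ⊎ Special a) as → Partition as
  partition [] [] = record
    { witnesses = [] ; specials = [] ; length-partition = refl ; witnessing = λ () ; special = λ ()
    ; witnesses-unique = [] ; specials-unique = [] }
  partition {a ∷ as} (a∉as ∷ u) (inj₁ (y , w) ∷ rest) = record
    { witnesses        = y ∷ witnesses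
    ; specials         = specials
    ; length-partition = cong suc length-partition
    ; witnessing       = λ { (here refl) → a , here refl , w
                           ; (there y∈) → let a' , a'∈ , w' = witnessing y∈ in a' , there a'∈ , w' }
    ; special          = λ a'∈ → let a'∈as , s = special a'∈ in there a'∈as , s
    ; witnesses-unique = ¬Any⇒All¬ _ y∉ ∷ witnesses-unique
    ; specials-unique  = specials-unique
    }
    where
    open Partition (partition u rest)
    y∉ : y ∉ witnesses
    y∉ y∈ with witnessing y∈
    ... | a' , a'∈as , w' with Witness-injective w w'
    ...   | refl = All¬⇒¬Any a∉as a'∈as
  partition {a ∷ as} (a∉as ∷ u) (inj₂ s ∷ rest) = record
    { witnesses        = witnesses
    ; specials         = a ∷ specials
    ; length-partition = trans (+-suc _ _) (cong suc length-partition)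
    ; witnessing       = λ y∈ → let a' , a'∈ , w' = witnessing y∈ in a' , there a'∈ , w'
    ; special          = λ { (here refl) → here refl , s
                           ; (there a'∈) → let a'∈as , s' = special a'∈ in there a'∈as , s' }
    ; witnesses-unique = witnesses-unique
    ; specials-unique  = ¬Any⇒All¬ _ (All¬⇒¬Any a∉as ∘ proj₁ ∘ special) ∷ specials-unique
    }
    where open Partition (partition u rest)

counting-bound : ∀ {c w s b m a} → c + w ≤ m → w + s ≡ b → s ≤ a → c ≤ m ∸ b + a
counting-bound {c} {w} {s} {_} {m} {a} c+w≤m refl s≤a = begin
  c                 ≤⟨ m+n≤o⇒m≤o∸n c c+w≤m ⟩
  m ∸ w             ≤⟨ m≤n+m∸n (m ∸ w) s ⟩
  s + (m ∸ w ∸ s)   ≡⟨ cong (s +_) (∸-+-assoc m w s) ⟩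
  s + (m ∸ (w + s)) ≤⟨ +-monoˡ-≤ _ s≤a ⟩
  a + (m ∸ (w + s)) ≡⟨ +-comm a _ ⟩
  m ∸ (w + s) + a   ∎
  where open ≤-Reasoning

module GraphBasics {n : ℕ} (G : Graph n) where

  Adj-sym : ∀ {u v} → Adj G u v → Adj G v u
  Adj-sym {u} {v} = subst T (Graph.sym G u v)

  Adj⇒≢ : ∀ {u v} → Adj G u v → u ≢ v
  Adj⇒≢ {u} a refl = subst T (Graph.irrefl G u) a

  Pendant : Fin n → Set
  Pendant x = ∀ {y y'} → Adj G x y → Adj G x y' → y ≡ y'

  _++ʷ_ : ∀ {u v w k m} → Walk G u v k → Walk G v w m → Walk G u w (k + m)
  here     ++ʷ W' = W'
  step a W ++ʷ W' = step a (W ++ʷ W')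

  walk? : ∀ k u v → Dec (Walk G u v k)
  walk? zero u v with u ≟ᶠ v
  ... | yes refl = yes here
  ... | no  u≢v  = no λ { here → u≢v refl }
  walk? (suc k) u v with any? (λ w → T? (adj G u w) ×-dec walk? k w v)
  ... | yes (w , a , W) = yes (step a W)
  ... | no  none        = no λ { (step a W) → none (_ , a , W) }

  vertex-at : ∀ {u v k} → Walk G u v k → ℕ → Fin n
  vertex-at {u} here       _       = u
  vertex-at {u} (step a W) zero    = u
  vertex-at     (step a W) (suc j) = vertex-at W j

  vertex-at-0 : ∀ {u v k} (W : Walk G u v k) → vertex-at W 0 ≡ u
  vertex-at-0 here       = refl
  vertex-at-0 (step a W) = refl

  take-walk : ∀ {u v k} (W : Walk G u v k) {j} → j ≤ k → Walk G u (vertex-at W j) j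
  take-walk here       z≤n           = here
  take-walk (step a W) {zero}  _       = here
  take-walk (step a W) {suc j} (s≤s j≤k) = step a (take-walk W j≤k)

  drop-walk : ∀ {u v k} (W : Walk G u v k) {j} → j ≤ k → Walk G (vertex-at W j) v (k ∸ j)
  drop-walk here       z≤n           = here
  drop-walk (step a W) {zero}  _       = step a W
  drop-walk (step a W) {suc j} (s≤s j≤k) = drop-walk W j≤k

  vertex-at-Adj : ∀ {u v k} (W : Walk G u v k) {j} → suc j ≤ k →
                  Adj G (vertex-at W j) (vertex-at W (suc j))
  vertex-at-Adj (step a W) {zero}  _         = subst (Adj G _) (sym (vertex-at-0 W)) a
  vertex-at-Adj (step a W) {suc j} (s≤s j<k) = vertex-at-Adj W j<k

  IsGeodesic : ∀ {u v k} → Walk G u v k → Set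
  IsGeodesic {u} {v} {k} _ = ∀ m → Walk G u v m → k ≤ m

  module _ {u v k} (W : Walk G u v k) (geodesic : IsGeodesic W) where

    geodesic-take-minimal : ∀ {j m} → j ≤ k → Walk G u (vertex-at W j) m → j ≤ m
    geodesic-take-minimal {j} {m} j≤k W' = +-cancelʳ-≤ (k ∸ j) j m
      (subst (_≤ m + (k ∸ j)) (sym (m+[n∸m]≡n j≤k)) (geodesic _ (W' ++ʷ drop-walk W j≤k)))

    geodesic-injective : ∀ {i j} → i < j → j ≤ k → vertex-at W i ≢ vertex-at W j
    geodesic-injective i<j j≤k eq = <⇒≱ i<j
      (geodesic-take-minimal j≤k (subst (λ z → Walk G u z _) eq (take-walk W (≤-trans (<⇒≤ i<j) j≤k))))

    geodesic-inner-¬Pendant : ∀ {j} → suc (suc j) ≤ k → ¬ Pendant (vertex-at W (suc j))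
    geodesic-inner-¬Pendant {j} j+2≤k pendant = geodesic-injective (m<n⇒m<1+n ≤-refl) j+2≤k
      (pendant (Adj-sym (vertex-at-Adj W {j} (≤-trans (n≤1+n _) j+2≤k))) (vertex-at-Adj W j+2≤k))

  distance : Connected G → ∀ u v → ∃[ d ] Dist G u v d
  distance connected u v with least-witness (λ d → walk? d u v) _ (proj₂ (connected u v))
  ... | d , W , shorter = d , W , λ k W' → ≮⇒≥ (λ k<d → shorter k<d W')

  eccentricity : Connected G → ∀ v → ∃[ e ] IsEcc G v e
  eccentricity connected v = d far , bounded , far , proj₂ (distance connected v far)
    where
    d : Fin n → ℕ
    d u = proj₁ (distance connected v u)
    far = argmax d v (allFin n)
    bounded : ∀ u k → Dist G v u k → k ≤ d far
    bounded u k (_ , minimal) = ≤-trans (minimal (d u) (proj₁ (proj₂ (distance connected v u))))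
                            (All-lookup (f[xs]≤f[argmax] v (allFin n)) (∈-allFin u))

  applyUpTo-PathFrom : ∀ (g : ℕ → Fin n) d → (∀ {t} → t < d → Adj G (g t) (g (suc t))) →
                       PathFrom G (g 0) (g d) (applyUpTo g (suc d))
  applyUpTo-PathFrom g zero    _   = single
  applyUpTo-PathFrom g (suc d) adj = cons (adj z<s) (applyUpTo-PathFrom (g ∘ suc) d (adj ∘ s≤s))

  applyDownFrom-PathFrom : ∀ (g : ℕ → Fin n) d → (∀ {t} → t < d → Adj G (g (suc t)) (g t)) →
                           PathFrom G (g d) (g 0) (applyDownFrom g (suc d))
  applyDownFrom-PathFrom g zero    _   = single
  applyDownFrom-PathFrom g (suc d) adj = cons (adj ≤-refl) (applyDownFrom-PathFrom g d (adj ∘ m<n⇒m<1+n))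

  PathFrom-snoc : ∀ {u v w xs} → PathFrom G u v xs → Adj G v w → PathFrom G u w (xs ++ [ w ])
  PathFrom-snoc single     a = cons a single
  PathFrom-snoc (cons b P) a = cons b (PathFrom-snoc P a)

  deg≤2 : ∀ {x} a c → (∀ {y} → Adj G x y → y ≡ a ⊎ y ≡ c) → deg G x ≤ 2
  deg≤2 {x} a c neighbours = begin
    deg G x
      ≤⟨ sum-map-mono indicator≤ (allFin n) ⟩
    sum (map (λ u → ⟦ u ≡ a ⟧ + ⟦ u ≡ c ⟧) (allFin n))
      ≡⟨ sum-map-+ ⟦_≡ a ⟧ ⟦_≡ c ⟧ (allFin n) ⟩
    sum (map ⟦_≡ a ⟧ (allFin n)) + sum (map ⟦_≡ c ⟧ (allFin n))
      ≤⟨ +-mono-≤ (occurrences≤1 a (allFin⁺ n)) (occurrences≤1 c (allFin⁺ n)) ⟩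
    2 ∎
    where
    open ≤-Reasoning
    indicator≤ : ∀ u → (if adj G x u then 1 else 0) ≤ ⟦ u ≡ a ⟧ + ⟦ u ≡ c ⟧
    indicator≤ u with adj G x u in x~u
    ... | false = z≤n
    ... | true with neighbours (subst T (sym x~u) tt)
    ...   | inj₁ refl = ≤-trans (1≤⟦a≡a⟧ a) (m≤m+n _ _)
    ...   | inj₂ refl = ≤-trans (1≤⟦a≡a⟧ c) (m≤n+m _ _)

  Branch⇒¬Leaf : ∀ {x} → IsBranch G x → ¬ IsLeaf G x
  Branch⇒¬Leaf branch leaf with ≤-trans branch (≤-reflexive leaf)
  ... | s≤s ()

  ¬Branch-of-two : ∀ {x} a c → (∀ {y} → Adj G x y → y ≡ a ⊎ y ≡ c) → ¬ IsBranch G x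
  ¬Branch-of-two a c neighbours branch = 1+n≰n (≤-trans branch (deg≤2 a c neighbours))

module Spine {n : ℕ} (G : Graph n) (acyclic : ¬ HasCycle G) (p : ℕ → Fin n) (L : ℕ)
  (p-Adj : ∀ {i} → suc i < L → Adj G (p i) (p (suc i)))
  (p-injective : ∀ {i j} → i < L → j < L → p i ≡ p j → i ≡ j)
  (dominating : ∀ x → (∃[ i ] (i < L × p i ≡ x)) ⊎ (∃[ i ] (i < L × Adj G x (p i))))
  where

  open GraphBasics G

  OnSpine : Fin n → Set
  OnSpine x = ∃[ i ] (i < L × p i ≡ x)

  OffSpine : Fin n → Set
  OffSpine x = ¬ OnSpine x

  onSpine? : ∀ x → Dec (OnSpine x)
  onSpine? x = anyUpTo? (λ i → p i ≟ᶠ x) L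

  no-closing-edge : ∀ {u v xs} → IsPath G u v xs → 3 ≤ length xs → ¬ Adj G v u
  no-closing-edge path 3≤len a = acyclic (_ , _ , _ , path , 3≤len , a)

  private
    shifted-Adj : ∀ b {t} → b + suc t < L → Adj G (p (b + t)) (p (b + suc t))
    shifted-Adj b {t} lt =
      subst (λ k → Adj G (p (b + t)) (p k)) (sym (+-suc b t)) (p-Adj (subst (_< L) (+-suc b t) lt))

    shifted-injective : ∀ b {t t'} → b + t' < L → t < t' → p (b + t) ≢ p (b + t')
    shifted-injective b b+t'<L t<t' eq =
      <⇒≢ t<t' (+-cancelˡ-≡ b _ _ (p-injective (<-trans (+-monoʳ-< b t<t') b+t'<L) b+t'<L eq))

    +-≤-∸ : ∀ {i j t} → i ≤ j → t ≤ j ∸ i → i + t ≤ j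
    +-≤-∸ {i} i≤j t≤j∸i = subst (i + _ ≤_) (m+[n∸m]≡n i≤j) (+-monoʳ-≤ i t≤j∸i)

  SpinePath : ℕ → ℕ → List (Fin n) → Set
  SpinePath i j xs =
    IsPath G (p i) (p j) xs × j ∸ i < length xs × (∀ {y} → y ∈ xs → ∃[ t ] (Between i j t × p t ≡ y))

  ascending-SpinePath : ∀ {i j} → i ≤ j → j < L →
                        SpinePath i j (applyUpTo (p ∘ (i +_)) (suc (j ∸ i)))
  ascending-SpinePath {i} {j} i≤j j<L =
    (subst₂ (λ a b → PathFrom G a b (applyUpTo (p ∘ (i +_)) (suc (j ∸ i))))
            (cong p (+-identityʳ i)) (cong p (m+[n∸m]≡n i≤j))
       (applyUpTo-PathFrom (p ∘ (i +_)) (j ∸ i)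
         (λ t<d → shifted-Adj i (≤-<-trans (+-≤-∸ i≤j t<d) j<L))) ,
     applyUpTo⁺₁ (p ∘ (i +_)) (suc (j ∸ i))
       (λ t<t' t'≤d → shifted-injective i (≤-<-trans (+-≤-∸ i≤j (s≤s⁻¹ t'≤d)) j<L) t<t')) ,
    ≤-reflexive (sym (length-applyUpTo (p ∘ (i +_)) (suc (j ∸ i)))) ,
    λ y∈ → let t , t≤d , y≡ = ∈-applyUpTo⁻ (p ∘ (i +_)) y∈ in
      i + t , inj₁ (m≤m+n i t , +-≤-∸ i≤j (s≤s⁻¹ t≤d)) , sym y≡

  descending-SpinePath : ∀ {i j} → j ≤ i → i < L →
                         SpinePath i j (applyDownFrom (p ∘ (j +_)) (suc (i ∸ j)))
  descending-SpinePath {i} {j} j≤i i<L =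
    (subst₂ (λ a b → PathFrom G a b (applyDownFrom (p ∘ (j +_)) (suc (i ∸ j))))
            (cong p (m+[n∸m]≡n j≤i)) (cong p (+-identityʳ j))
       (applyDownFrom-PathFrom (p ∘ (j +_)) (i ∸ j)
         (λ t<d → Adj-sym (shifted-Adj j (≤-<-trans (+-≤-∸ j≤i t<d) i<L)))) ,
     applyDownFrom⁺₁ (p ∘ (j +_)) (suc (i ∸ j))
       (λ t'<t t≤d → shifted-injective j (≤-<-trans (+-≤-∸ j≤i (s≤s⁻¹ t≤d)) i<L) t'<t ∘ sym)) ,
    subst (_< suc (length (applyDownFrom (p ∘ (j +_)) (i ∸ j)))) (sym (m≤n⇒m∸n≡0 j≤i)) z<s ,
    λ y∈ → let t , t≤d , y≡ = ∈-applyDownFrom⁻ (p ∘ (j +_)) y∈ in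
      j + t , inj₂ (m≤m+n j t , +-≤-∸ j≤i (s≤s⁻¹ t≤d)) , sym y≡

  spine-path : ∀ {i j} → i < L → j < L → ∃[ xs ] SpinePath i j xs
  spine-path {i} {j} i<L j<L with i ≤? j
  ... | yes i≤j = _ , ascending-SpinePath i≤j j<L
  ... | no  i≰j = _ , descending-SpinePath (<⇒≤ (≰⇒> i≰j)) i<L

  OffSpine-∉-SpinePath : ∀ {x i j xs} → OffSpine x → i < L → j < L → SpinePath i j xs → x ∉ xs
  OffSpine-∉-SpinePath off i<L j<L (_ , _ , members) x∈xs with members x∈xs
  ... | t , between , p≡x = off (t , Between⇒< between i<L j<L , p≡x)

  spine-Adj-forward : ∀ {i j} → i < L → j < L → i < j → Adj G (p i) (p j) → j ≡ suc i
  spine-Adj-forward {i} {j} i<L j<L i<j a with j ≤? suc i | spine-path i<L j<L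
  ... | yes j≤1+i | _ = ≤-antisym j≤1+i i<j
  ... | no  j≰1+i | xs , path , long , _ =
    ⊥-elim (no-closing-edge path (≤-trans (s≤s (m+n≤o⇒m≤o∸n 2 (≰⇒> j≰1+i))) long) (Adj-sym a))

  spine-Adj⇒consecutive : ∀ {i j} → i < L → j < L → Adj G (p i) (p j) → j ≡ suc i ⊎ i ≡ suc j
  spine-Adj⇒consecutive {i} {j} i<L j<L a with <-cmp i j
  ... | tri< i<j _ _  = inj₁ (spine-Adj-forward i<L j<L i<j a)
  ... | tri≈ _ refl _ = ⊥-elim (Adj⇒≢ a refl)
  ... | tri> _ _ j<i  = inj₂ (spine-Adj-forward j<L i<L j<i (Adj-sym a))

  anchor : ∀ {x} → OffSpine x → ∃[ i ] (i < L × Adj G x (p i))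
  anchor {x} off with dominating x
  ... | inj₁ on     = ⊥-elim (off on)
  ... | inj₂ anchor = anchor

  OffSpine-anchor-forward : ∀ {x i j} → OffSpine x → i < L → j < L → i < j →
                            Adj G x (p i) → Adj G x (p j) → ⊥
  OffSpine-anchor-forward off i<L j<L i<j x~pi x~pj with spine-path i<L j<L
  ... | xs , spine@((P , U) , long , _) =
    no-closing-edge (cons x~pi P , ¬Any⇒All¬ _ (OffSpine-∉-SpinePath off i<L j<L spine) ∷ U)
      (s≤s (≤-trans (s≤s (m<n⇒0<n∸m i<j)) long)) (Adj-sym x~pj)

  OffSpine-anchor-unique : ∀ {x i j} → OffSpine x → i < L → j < L →
                           Adj G x (p i) → Adj G x (p j) → i ≡ j
  OffSpine-anchor-unique {i = i} {j} off i<L j<L x~pi x~pj with <-cmp i j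
  ... | tri< i<j _ _ = ⊥-elim (OffSpine-anchor-forward off i<L j<L i<j x~pi x~pj)
  ... | tri≈ _ i≡j _ = i≡j
  ... | tri> _ _ j<i = ⊥-elim (OffSpine-anchor-forward off j<L i<L j<i x~pj x~pi)

  private
    OffSpine-¬Adj-forward : ∀ {x z i j} → OffSpine x → OffSpine z → Adj G x z →
                            i ≤ j → i < L → j < L → Adj G x (p i) → Adj G z (p j) → ⊥
    OffSpine-¬Adj-forward offx offz x~z i≤j i<L j<L x~pi z~pj with spine-path i<L j<L
    ... | xs , spine@((P , U) , long , _) =
      no-closing-edge
        (cons (Adj-sym x~z) (cons x~pi P) ,
         (Adj⇒≢ (Adj-sym x~z) ∷ ¬Any⇒All¬ _ (OffSpine-∉-SpinePath offz i<L j<L spine)) ∷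
         ¬Any⇒All¬ _ (OffSpine-∉-SpinePath offx i<L j<L spine) ∷ U)
        (s≤s (s≤s (≤-trans (s≤s z≤n) long))) (Adj-sym z~pj)

  OffSpine-¬Adj : ∀ {x z} → OffSpine x → OffSpine z → ¬ Adj G x z
  OffSpine-¬Adj offx offz x~z with anchor offx | anchor offz
  ... | i , i<L , x~pi | j , j<L , z~pj with i ≤? j
  ...   | yes i≤j = OffSpine-¬Adj-forward offx offz x~z i≤j i<L j<L x~pi z~pj
  ...   | no  i≰j = OffSpine-¬Adj-forward offz offx (Adj-sym x~z) (<⇒≤ (≰⇒> i≰j)) j<L i<L z~pj x~pi

  OffSpine-neighbour-OnSpine : ∀ {x y} → OffSpine x → Adj G x y → OnSpine y
  OffSpine-neighbour-OnSpine {y = y} offx x~y with onSpine? y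
  ... | yes on   = on
  ... | no  offy = ⊥-elim (OffSpine-¬Adj offx offy x~y)

  OffSpine⇒Pendant : ∀ {x} → OffSpine x → Pendant x
  OffSpine⇒Pendant off x~y x~y' with OffSpine-neighbour-OnSpine off x~y | OffSpine-neighbour-OnSpine off x~y'
  ... | i , i<L , refl | j , j<L , refl = cong p (OffSpine-anchor-unique off i<L j<L x~y x~y')

  OffSpine⇒¬Branch : ∀ {x} → OffSpine x → ¬ IsBranch G x
  OffSpine⇒¬Branch off with anchor off
  ... | i , _ , x~pi = ¬Branch-of-two (p i) (p i) (λ x~y → inj₁ (OffSpine⇒Pendant off x~y x~pi))

  Branch⇒OnSpine : ∀ {x} → IsBranch G x → OnSpine x
  Branch⇒OnSpine {x} branch with onSpine? x
  ... | yes on  = on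
  ... | no  off = ⊥-elim (OffSpine⇒¬Branch off branch)

  spine-neighbour : ∀ {i y} → i < L → Adj G (p i) y →
                    OffSpine y ⊎ (suc i < L × p (suc i) ≡ y) ⊎ ∃[ i' ] (i ≡ suc i' × p i' ≡ y)
  spine-neighbour {y = y} i<L pi~y with onSpine? y
  ... | no  off = inj₁ off
  ... | yes (j , j<L , refl) with spine-Adj⇒consecutive i<L j<L pi~y
  ...   | inj₁ refl = inj₂ (inj₁ (j<L , refl))
  ...   | inj₂ refl = inj₂ (inj₂ (j , refl , refl))

  Anchored : ℕ → Fin n → Set
  Anchored j x = p j ≡ x ⊎ (OffSpine x × Adj G x (p j))

  anchored : ∀ x → ∃[ j ] (j < L × Anchored j x)
  anchored x with onSpine? x
  ... | yes (j , j<L , p≡x) = j , j<L , inj₁ p≡x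
  ... | no  off with anchor off
  ...   | j , j<L , x~pj = j , j<L , inj₂ (off , x~pj)

  path-to-anchored : ∀ {i j x} → i < L → j < L → Anchored j x →
    ∃[ xs ] (IsPath G (p i) x xs × (∀ {y} → y ∈ xs → y ≡ x ⊎ ∃[ t ] (Between i j t × p t ≡ y)))
  path-to-anchored i<L j<L anchoring with spine-path i<L j<L
  path-to-anchored i<L j<L (inj₁ refl) | xs , path , _ , members = xs , path , λ y∈ → inj₂ (members y∈)
  path-to-anchored {x = x} i<L j<L (inj₂ (off , x~pj)) | xs , spine@((P , U) , _ , members) =
    xs ++ [ x ] , (PathFrom-snoc P (Adj-sym x~pj) , ++⁺ U ([] ∷ []) disjoint) , member
    where
    disjoint : ∀ {y} → ¬ (y ∈ xs × y ∈ [ x ])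
    disjoint (y∈xs , here refl) = OffSpine-∉-SpinePath off i<L j<L spine y∈xs
    member : ∀ {y} → y ∈ xs ++ [ x ] → y ≡ x ⊎ ∃[ t ] (Between _ _ t × p t ≡ y)
    member y∈ with ∈-++⁻ xs y∈
    ... | inj₁ y∈xs       = inj₂ (members y∈xs)
    ... | inj₂ (here y≡x) = inj₁ y≡x

module Broadcast {n : ℕ} (G : Graph n) (acyclic : ¬ HasCycle G) (p : ℕ → Fin n) (L : ℕ)
  (p-Adj : ∀ {i} → suc i < L → Adj G (p i) (p (suc i)))
  (p-injective : ∀ {i j} → i < L → j < L → p i ≡ p j → i ≡ j)
  (dominating : ∀ x → (∃[ i ] (i < L × p i ≡ x)) ⊎ (∃[ i ] (i < L × Adj G x (p i))))
  (connected : Connected G) (f : Fin n → ℕ) (broadcast : IsBroadcast G f)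
  (independent : BoundaryIndependent G f)
  where

  open GraphBasics G
  open Spine G acyclic p L p-Adj p-injective dominating

  Interior : Fin n → Fin n → Set
  Interior v u = ∃[ m ] (m < f v × Walk G v u m)

  Interior⇒Hears : ∀ {v u} → Interior v u → Hears G f u v
  Interior⇒Hears (m , m<fv , W) = ≤-<-trans z≤n m<fv , m , <⇒≤ m<fv , W

  Interior-private : ∀ {v u w} → Interior v u → Hears G f u w → w ≡ v
  Interior-private {v} {u} interior@(m , m<fv , W) u-hears-w =
    proj₂ (independent v (proj₁ u-hears-v) u u-hears-v not-boundary) _ u-hears-w
    where
    u-hears-v = Interior⇒Hears interior
    not-boundary : ¬ InBoundary G f u v
    not-boundary (_ , _ , minimal) = <⇒≱ m<fv (minimal m W)

  Overheard : Fin n → Set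
  Overheard u = ∃[ v ] Interior v u

  overheard? : ∀ u → Dec (Overheard u)
  overheard? u = any? λ v → anyUpTo? (λ m → walk? m v u) (f v)

  record Ray (v : Fin n) : Set where
    field
      end      : Fin n
      reach    : ℕ
      walk     : Walk G v end reach
      geodesic : IsGeodesic walk
      f≤reach  : f v ≤ reach

  -- Opaque so that type checking never unfolds the eccentricity computation.
  opaque
    ray : ∀ v → Ray v
    ray v with eccentricity connected v
    ... | e , bounded , u , W , minimal = record
      { walk = W ; geodesic = minimal ; f≤reach = broadcast v e (bounded , u , W , minimal) }

  ray-at : Fin n → ℕ → Fin n
  ray-at v = vertex-at (Ray.walk (ray v))

  module _ {v : Fin n} where
    open Ray (ray v)

    private
      ≤f⇒≤reach : ∀ {j} → j ≤ f v → j ≤ reach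
      ≤f⇒≤reach j≤fv = ≤-trans j≤fv f≤reach

    ray-at-0 : ray-at v 0 ≡ v
    ray-at-0 = vertex-at-0 walk

    ray-at-Interior : ∀ {j} → j < f v → Interior v (ray-at v j)
    ray-at-Interior j<fv = _ , j<fv , take-walk walk (≤f⇒≤reach (<⇒≤ j<fv))

    ray-at-Adj : ∀ {j} → suc j ≤ f v → Adj G (ray-at v j) (ray-at v (suc j))
    ray-at-Adj j<fv = vertex-at-Adj walk (≤f⇒≤reach j<fv)

    ray-at-injective : ∀ {i j} → i < j → j ≤ f v → ray-at v i ≢ ray-at v j
    ray-at-injective i<j j≤fv = geodesic-injective walk geodesic i<j (≤f⇒≤reach j≤fv)

    ray-at-minimal : ∀ {j m} → j ≤ f v → Walk G v (ray-at v j) m → j ≤ m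
    ray-at-minimal j≤fv = geodesic-take-minimal walk geodesic (≤f⇒≤reach j≤fv)

    ray-inner-¬Pendant : ∀ {j} → suc j < f v → ¬ Pendant (ray-at v (suc j))
    ray-inner-¬Pendant j+1<fv = geodesic-inner-¬Pendant walk geodesic (≤f⇒≤reach j+1<fv)

  ray-first-step : ∀ {v b} → Pendant v → Adj G v b → 0 < f v → ray-at v 1 ≡ b
  ray-first-step {v} pendant v~b 0<fv =
    pendant (subst (λ z → Adj G z (ray-at v 1)) (ray-at-0 {v}) (ray-at-Adj {v} 0<fv)) v~b

  inner-ray : Fin n → List (Fin n)
  inner-ray v = applyUpTo (ray-at v) (f v)

  K : List (Fin n)
  K = concatMap inner-ray (allFin n)

  ∈K⇒ray : ∀ {y} → y ∈ K → ∃[ v ] ∃[ j ] (j < f v × ray-at v j ≡ y)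
  ∈K⇒ray y∈K with find (∈-concatMap⁻ inner-ray {allFin n} y∈K)
  ... | v , _ , y∈ray with ∈-applyUpTo⁻ (ray-at v) y∈ray
  ...   | j , j<fv , y≡ = v , j , j<fv , sym y≡

  ¬Overheard⇒∉K : ∀ {y} → ¬ Overheard y → y ∉ K
  ¬Overheard⇒∉K ¬heard y∈K with ∈K⇒ray y∈K
  ... | v , j , j<fv , refl = ¬heard (v , ray-at-Interior j<fv)

  K-unique : Unique K
  K-unique = concatMap⁺ inner-ray (allFin⁺ n) inner-ray-unique apart
    where
    inner-ray-unique : ∀ v → Unique (inner-ray v)
    inner-ray-unique v = applyUpTo⁺₁ (ray-at v) (f v) λ i<j j<fv → ray-at-injective i<j (<⇒≤ j<fv)
    apart : ∀ {v w y} → y ∈ inner-ray v → y ∈ inner-ray w → v ≡ w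
    apart {v} {w} y∈v y∈w with ∈-applyUpTo⁻ (ray-at v) y∈v | ∈-applyUpTo⁻ (ray-at w) y∈w
    ... | i , i<fv , refl | j , j<fw , y≡ =
      Interior-private (subst (Interior w) (sym y≡) (ray-at-Interior j<fw)) (Interior⇒Hears (ray-at-Interior i<fv))

  length-K : length K ≡ cost G f
  length-K = trans (length-concatMap inner-ray (allFin n))
                   (cong sum (map-cong (λ v → length-applyUpTo (ray-at v) (f v)) (allFin n)))

  pendant-∉K : ∀ {v b ℓ} → Interior v b → OffSpine ℓ → Adj G b ℓ → ℓ ≢ v → ℓ ∉ K
  pendant-∉K {v} {b} {ℓ} interior off b~ℓ ℓ≢v ℓ∈K with ∈K⇒ray ℓ∈K
  ... | w , zero , 0<fw , ray≡ℓ = ℓ≢v (trans ℓ≡w (Interior-private interior b-hears-w))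
    where
    ℓ≡w : ℓ ≡ w
    ℓ≡w = trans (sym ray≡ℓ) ray-at-0
    b-hears-w : Hears G f b w
    b-hears-w = 0<fw , 1 , 0<fw , step (subst (λ z → Adj G z b) ℓ≡w (Adj-sym b~ℓ)) here
  ... | w , suc j , j+1<fw , ray≡ℓ =
    ray-inner-¬Pendant j+1<fw (subst Pendant (sym ray≡ℓ) (OffSpine⇒Pendant off))

  -- y lies inside the ball of v at distance 2, so in K it could only be the third vertex of the ray from v.
  beyond-∉K : ∀ {v b y} → OffSpine v → Adj G v b → Adj G b y → OnSpine y →
              y ≢ ray-at v 2 → 3 ≤ f v → y ∉ K
  beyond-∉K {v} {b} {y} off v~b b~y on y≢ray 3≤fv y∈K with ∈K⇒ray y∈K
  ... | w , j , j<fw , ray≡y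
    with Interior-private (2 , 3≤fv , step v~b (step b~y here))
                          (Interior⇒Hears (subst (Interior w) ray≡y (ray-at-Interior j<fw)))
  ...   | refl = at-most-two j
    (ray-at-minimal (<⇒≤ j<fw) (subst (λ z → Walk G v z 2) (sym ray≡y) (step v~b (step b~y here)))) ray≡y
    where
    at-most-two : ∀ j → j ≤ 2 → ray-at v j ≢ y
    at-most-two 0 _ ray≡y = off (subst OnSpine (trans (sym ray≡y) ray-at-0) on)
    at-most-two 1 _ ray≡y =
      Adj⇒≢ b~y (trans (sym (ray-first-step (OffSpine⇒Pendant off) v~b (≤-trans z<s 3≤fv))) ray≡y)
    at-most-two 2 _ ray≡y = y≢ray (sym ray≡y)
    at-most-two (suc (suc (suc _))) (s≤s (s≤s ())) _

  power-two-Hears : ∀ {v x} → f v ≡ 2 → Walk G v x 2 → Hears G f x v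
  power-two-Hears fv≡2 W = subst (0 <_) (sym fv≡2) z<s , 2 , ≤-reflexive (sym fv≡2) , W

  two-steps-¬Overheard : ∀ {v b y} → OffSpine v → Adj G v b → f v ≡ 2 → Adj G b y → OnSpine y →
                         ¬ Overheard y
  two-steps-¬Overheard {v} {b} {y} off v~b fv≡2 b~y on (w , interior)
    with Interior-private interior (power-two-Hears fv≡2 (step v~b (step b~y here)))
  ... | refl = inside interior
    where
    inside : ¬ Interior v y
    inside (zero , _ , here)              = off on
    inside (suc zero , _ , step v~y here) = Adj⇒≢ b~y (OffSpine⇒Pendant off v~b v~y)
    inside (suc (suc m) , m+2<fv , _) with subst (suc (suc (suc m)) ≤_) fv≡2 m+2<fv
    ... | s≤s (s≤s ())

  LeftBranch : ℕ → Set
  LeftBranch i = ∃[ m ] (m < i × IsBranch G (p m))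

  data Witness (b y : Fin n) : Set where
    itself  : y ≡ b → IsBranch G b → ¬ Overheard b → Witness b y
    pendant : OffSpine y → Adj G y b → Witness b y
    beyond  : ∀ v → Interior v y → OnSpine y → OffSpine v → Adj G v b → Witness b y
    right   : ∀ i → suc i < L → p i ≡ b → IsBranch G b → p (suc i) ≡ y →
              ¬ Overheard y → ¬ IsBranch G y → Witness b y
    left    : ∀ i → suc i < L → p (suc i) ≡ b → p i ≡ y →
              ¬ Overheard y → ¬ LeftBranch (suc i) → Witness b y

  private
    right-left-conflict : ∀ {b y i i'} → suc i < L → p i ≡ b → IsBranch G b → p (suc i) ≡ y →
                          suc i' < L → p i' ≡ y → ¬ LeftBranch (suc i') → ⊥
    right-left-conflict {i = i} i+1<L refl branch refl i'+1<L pi'≡y no-left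
      with p-injective i+1<L (≤-trans (n≤1+n _) i'+1<L) (sym pi'≡y)
    ... | refl = no-left (i , m<n⇒m<1+n ≤-refl , branch)

    left-¬Branch : ∀ {i y} → p i ≡ y → ¬ LeftBranch (suc i) → ¬ IsBranch G y
    left-¬Branch refl no-left branch = no-left (_ , ≤-refl , branch)

  Witness-injective : ∀ {b b' y} → Witness b y → Witness b' y → b ≡ b'
  Witness-injective (itself refl _ _)  (itself refl _ _)  = refl
  Witness-injective (itself refl br _) (pendant off _)   = ⊥-elim (OffSpine⇒¬Branch off br)
  Witness-injective (itself refl _ ¬o) (beyond v int _ _ _) = ⊥-elim (¬o (v , int))
  Witness-injective (itself refl br _) (right _ _ _ _ _ _ ¬br) = ⊥-elim (¬br br)
  Witness-injective (itself refl br _) (left _ _ _ e _ nl) = ⊥-elim (left-¬Branch e nl br)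
  Witness-injective (pendant off _) (itself refl br _) = ⊥-elim (OffSpine⇒¬Branch off br)
  Witness-injective (pendant off y~b) (pendant _ y~b') = OffSpine⇒Pendant off y~b y~b'
  Witness-injective (pendant off _) (beyond _ _ on _ _) = ⊥-elim (off on)
  Witness-injective (pendant off _) (right i i+1<L _ _ e _ _) = ⊥-elim (off (suc i , i+1<L , e))
  Witness-injective (pendant off _) (left i i+1<L _ e _ _) = ⊥-elim (off (i , ≤-trans (n≤1+n _) i+1<L , e))
  Witness-injective (beyond v int _ _ _) (itself refl _ ¬o) = ⊥-elim (¬o (v , int))
  Witness-injective (beyond _ _ on _ _) (pendant off _) = ⊥-elim (off on)
  Witness-injective (beyond v int _ off v~b) (beyond v' int' _ _ v'~b')
    with Interior-private int (Interior⇒Hears int')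
  ... | refl = OffSpine⇒Pendant off v~b v'~b'
  Witness-injective (beyond v int _ _ _) (right _ _ _ _ _ ¬o _) = ⊥-elim (¬o (v , int))
  Witness-injective (beyond v int _ _ _) (left _ _ _ _ ¬o _) = ⊥-elim (¬o (v , int))
  Witness-injective (right _ _ _ _ _ _ ¬br) (itself refl br _) = ⊥-elim (¬br br)
  Witness-injective (right i i+1<L _ _ e _ _) (pendant off _) = ⊥-elim (off (suc i , i+1<L , e))
  Witness-injective (right _ _ _ _ _ ¬o _) (beyond v int _ _ _) = ⊥-elim (¬o (v , int))
  Witness-injective (right i i+1<L e₁ _ e₂ _ _) (right i' i'+1<L e₁' _ e₂' _ _)
    with p-injective i+1<L i'+1<L (trans e₂ (sym e₂'))
  ... | refl = trans (sym e₁) e₁'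
  Witness-injective (right _ i+1<L e₁ br e₂ _ _) (left _ i'+1<L _ e₂' _ nl) =
    ⊥-elim (right-left-conflict i+1<L e₁ br e₂ i'+1<L e₂' nl)
  Witness-injective (left _ _ _ e _ nl) (itself refl br _) = ⊥-elim (left-¬Branch e nl br)
  Witness-injective (left i i+1<L _ e _ _) (pendant off _) = ⊥-elim (off (i , ≤-trans (n≤1+n _) i+1<L , e))
  Witness-injective (left _ _ _ _ ¬o _) (beyond v int _ _ _) = ⊥-elim (¬o (v , int))
  Witness-injective (left _ i'+1<L _ e₂' _ nl) (right _ i+1<L e₁ br e₂ _ _) =
    ⊥-elim (right-left-conflict i+1<L e₁ br e₂ i'+1<L e₂' nl)
  Witness-injective (left i i+1<L e₁ e₂ _ _) (left i' i'+1<L e₁' e₂' _ _)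
    with p-injective (≤-trans (n≤1+n _) i+1<L) (≤-trans (n≤1+n _) i'+1<L) (trans e₂ (sym e₂'))
  ... | refl = trans (sym e₁) e₁'

  record ExceptionalAt (i : ℕ) : Set where
    field
      right-in     : suc i < L
      branch       : IsBranch G (p i)
      leaf         : Fin n
      leaf-off     : OffSpine leaf
      leaf-Adj     : Adj G leaf (p i)
      leaf-power   : f leaf ≡ 2
      sole-pendant : ∀ {ℓ} → OffSpine ℓ → Adj G (p i) ℓ → ℓ ≡ leaf
      right-branch : IsBranch G (p (suc i))
      left-branch  : LeftBranch i

  private module E = ExceptionalAt

  Exceptional : Fin n → Set
  Exceptional b = ∃[ i ] (p i ≡ b × ExceptionalAt i)

  Witnessed : Fin n → Set
  Witnessed b = ∃[ y ] (Witness b y × y ∉ K)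

  sole-pendant-structure : ∀ {i v} → i < L → IsBranch G (p i) →
                           (∀ {ℓ} → OffSpine ℓ → Adj G (p i) ℓ → ℓ ≡ v) →
                           OffSpine v × Adj G v (p i) × suc i < L × ∃[ i' ] (i ≡ suc i')
  sole-pendant-structure {zero} {v} i<L branch sole = ⊥-elim (¬Branch-of-two v (p 1) neighbours branch)
    where
    neighbours : ∀ {y} → Adj G (p 0) y → y ≡ v ⊎ y ≡ p 1
    neighbours p0~y with spine-neighbour i<L p0~y
    ... | inj₁ off                 = inj₁ (sole off p0~y)
    ... | inj₂ (inj₁ (_ , p1≡y))   = inj₂ (sym p1≡y)
    ... | inj₂ (inj₂ (_ , () , _))
  sole-pendant-structure {suc i'} {v} i<L branch sole
    with suc (suc i') <? L | ¬? (onSpine? v) ×-dec T? (adj G (p (suc i')) v)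
  ... | no i+1≮L | _ = ⊥-elim (¬Branch-of-two v (p i') neighbours branch)
    where
    neighbours : ∀ {y} → Adj G (p (suc i')) y → y ≡ v ⊎ y ≡ p i'
    neighbours pi~y with spine-neighbour i<L pi~y
    ... | inj₁ off                     = inj₁ (sole off pi~y)
    ... | inj₂ (inj₁ (i+1<L , _))      = ⊥-elim (i+1≮L i+1<L)
    ... | inj₂ (inj₂ (_ , refl , e))   = inj₂ (sym e)
  ... | yes i+1<L | no ¬pendant = ⊥-elim (¬Branch-of-two (p i') (p (suc (suc i'))) neighbours branch)
    where
    neighbours : ∀ {y} → Adj G (p (suc i')) y → y ≡ p i' ⊎ y ≡ p (suc (suc i'))
    neighbours pi~y with spine-neighbour i<L pi~y
    ... | inj₁ off                   = ⊥-elim (¬pendant (subst OffSpine y≡v off , subst (Adj G _) y≡v pi~y))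
      where y≡v = sole off pi~y
    ... | inj₂ (inj₁ (_ , e))        = inj₂ (sym e)
    ... | inj₂ (inj₂ (_ , refl , e)) = inj₁ (sym e)
  ... | yes i+1<L | yes (off , pi~v) = off , Adj-sym pi~v , i+1<L , i' , refl

  Interior-across⇒2≤f : ∀ {v u} → OffSpine v → OnSpine u → Interior v u → 2 ≤ f v
  Interior-across⇒2≤f off on (zero  , _      , here) = ⊥-elim (off on)
  Interior-across⇒2≤f off on (suc _ , m+1<fv , _)    = ≤-trans (s≤s (s≤s z≤n)) m+1<fv

  module _ {i v} (i+2<L : suc (suc i) < L) (branch : IsBranch G (p (suc i))) (interior : Interior v (p (suc i)))
           (off : OffSpine v) (v~b : Adj G v (p (suc i)))
           (sole : ∀ {ℓ} → OffSpine ℓ → Adj G (p (suc i)) ℓ → ℓ ≡ v) where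

    private
      i+1<L : suc i < L
      i+1<L = ≤-trans (n≤1+n _) i+2<L

      i<L : i < L
      i<L = ≤-trans (n≤1+n _) i+1<L

      left-Adj : Adj G (p (suc i)) (p i)
      left-Adj = Adj-sym (p-Adj i+1<L)

      right-Adj : Adj G (p (suc i)) (p (suc (suc i)))
      right-Adj = p-Adj i+2<L

      beyond-witness : ∀ {y} → Adj G (p (suc i)) y → OnSpine y → y ≢ ray-at v 2 → 3 ≤ f v →
                       Witnessed (p (suc i))
      beyond-witness b~y on y≢ray 3≤fv =
        _ , beyond v (2 , 3≤fv , step v~b (step b~y here)) on off v~b , beyond-∉K off v~b b~y on y≢ray 3≤fv

      power-two : f v ≡ 2 → Witnessed (p (suc i)) ⊎ Exceptional (p (suc i))
      power-two fv≡2 with 3 ≤? deg G (p (suc (suc i)))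
      ... | no ¬right-branch =
        inj₁ (_ , right (suc i) i+2<L refl branch refl right-quiet ¬right-branch , ¬Overheard⇒∉K right-quiet)
        where right-quiet = two-steps-¬Overheard off v~b fv≡2 right-Adj (_ , i+2<L , refl)
      ... | yes right-branch with anyUpTo? (λ m → 3 ≤? deg G (p m)) (suc i)
      ...   | no no-left = inj₁ (_ , left i i+1<L refl refl left-quiet no-left , ¬Overheard⇒∉K left-quiet)
        where left-quiet = two-steps-¬Overheard off v~b fv≡2 left-Adj (_ , i<L , refl)
      ...   | yes left-branch = inj₂ (suc i , refl , record
        { right-in = i+2<L ; branch = branch ; leaf = v ; leaf-off = off ; leaf-Adj = v~b ; leaf-power = fv≡2
        ; sole-pendant = sole ; right-branch = right-branch ; left-branch = left-branch })

    classify-sole-pendant : Witnessed (p (suc i)) ⊎ Exceptional (p (suc i))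
    classify-sole-pendant with 3 ≤? f v
    ... | no 3≰fv =
      power-two (≤-antisym (s≤s⁻¹ (≰⇒> 3≰fv)) (Interior-across⇒2≤f off (_ , i+1<L , refl) interior))
    ... | yes 3≤fv with ray-at v 2 ≟ᶠ p (suc (suc i))
    ...   | no  ray≢right = inj₁ (beyond-witness right-Adj (_ , i+2<L , refl) (ray≢right ∘ sym) 3≤fv)
    ...   | yes ray≡right = inj₁ (beyond-witness left-Adj (_ , i<L , refl) left≢right 3≤fv)
      where
      left≢right : p i ≢ ray-at v 2
      left≢right e = <⇒≢ (m<n⇒m<1+n ≤-refl) (p-injective i<L i+2<L (trans e ray≡right))

  no-other-pendant : ∀ {b v} → ¬ (∃[ ℓ ] (OffSpine ℓ × Adj G b ℓ × ℓ ≢ v)) →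
                     ∀ {ℓ} → OffSpine ℓ → Adj G b ℓ → ℓ ≡ v
  no-other-pendant none off b~ℓ = decidable-stable (_ ≟ᶠ _) λ ℓ≢v → none (_ , off , b~ℓ , ℓ≢v)

  classify : ∀ {b} → IsBranch G b → Witnessed b ⊎ Exceptional b
  classify branch with Branch⇒OnSpine branch
  ... | i , i<L , refl with overheard? (p i)
  ...   | no ¬heard = inj₁ (p i , itself refl branch ¬heard , ¬Overheard⇒∉K ¬heard)
  ...   | yes (v , interior) with any? (λ ℓ → ¬? (onSpine? ℓ) ×-dec T? (adj G (p i) ℓ) ×-dec ¬? (ℓ ≟ᶠ v))
  ...     | yes (ℓ , off , pi~ℓ , ℓ≢v) =
    inj₁ (ℓ , pendant off (Adj-sym pi~ℓ) , pendant-∉K interior off pi~ℓ ℓ≢v)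
  ...     | no  no-other with sole-pendant-structure i<L branch (no-other-pendant no-other)
  ...       | off , v~b , i+1<L , i' , refl =
    classify-sole-pendant i+1<L branch interior off v~b (no-other-pendant no-other)

  module _ {i} (exceptional : ExceptionalAt i) where
    open ExceptionalAt exceptional

    private
      i<L : i < L
      i<L = ≤-trans (n≤1+n _) right-in

      ¬Separates-via : ∀ {m j l} → m < L → j < L → IsBranch G (p m) → m ≢ i → Anchored j l →
                       (∀ {t} → Between m j t → t ≢ i) → IsLeaf G l → ¬ Separates G (p i) l
      ¬Separates-via {m} m<L j<L m-branch m≢i anchoring avoids l-leaf separates
        with path-to-anchored m<L j<L anchoring
      ... | xs , path , members with members (separates (p m) m-branch (m≢i ∘ p-injective m<L i<L) xs path)
      ...   | inj₁ pi≡l                 = Branch⇒¬Leaf branch (subst (IsLeaf G) (sym pi≡l) l-leaf)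
      ...   | inj₂ (t , between , pt≡pi) = avoids between (p-injective (Between⇒< between m<L j<L) i<L pt≡pi)

    separated-leaf : ∀ {l} → IsLeaf G l → Separates G (p i) l → l ≡ leaf
    separated-leaf {l} l-leaf separates with anchored l
    ... | j , j<L , anchoring with <-cmp j i
    ...   | tri< j<i _ _ with left-branch
    ...     | m , m<i , m-branch = ⊥-elim (¬Separates-via (<-trans m<i i<L) j<L m-branch (<⇒≢ m<i) anchoring
                                          (<⇒≢ ∘ λ between → Between⇒< between m<i j<i) l-leaf separates)
    separated-leaf l-leaf separates | j , j<L , anchoring | tri> _ _ i<j =
      ⊥-elim (¬Separates-via right-in j<L right-branch (<⇒≢ ≤-refl ∘ sym) anchoring
               (λ between → <⇒≢ (Between⇒> between ≤-refl i<j) ∘ sym) l-leaf separates)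
    separated-leaf l-leaf separates | j , j<L , inj₁ pi≡l | tri≈ _ refl _ =
      ⊥-elim (Branch⇒¬Leaf branch (subst (IsLeaf G) (sym pi≡l) l-leaf))
    separated-leaf l-leaf separates | j , j<L , inj₂ (off , l~pi) | tri≈ _ refl _ = sole-pendant off (Adj-sym l~pi)

    leaf-Interior : Interior leaf (p i)
    leaf-Interior = 1 , subst (1 <_) (sym leaf-power) ≤-refl , step leaf-Adj here

  Exceptional⇒InR : ∀ {b} → Exceptional b → InR G b
  Exceptional⇒InR (i , refl , exceptional) = ExceptionalAt.branch exceptional , λ l l' leaf leaf' sep sep' →
    trans (separated-leaf exceptional leaf sep) (sym (separated-leaf exceptional leaf' sep'))

  -- p i lies inside the ball of its leaf and hears the leaf of p j, so the two leaves coincide.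
  Exceptional-¬Adj : ∀ {b b'} → Exceptional b → Exceptional b' → ¬ Adj G b b'
  Exceptional-¬Adj (i , refl , e) (j , refl , e') pi~pj
    with Interior-private (leaf-Interior e)
           (power-two-Hears (E.leaf-power e') (step (E.leaf-Adj e') (step (Adj-sym pi~pj) here)))
  ... | leaf≡ = Adj⇒≢ pi~pj
    (OffSpine⇒Pendant (E.leaf-off e) (E.leaf-Adj e) (subst (λ z → Adj G z _) leaf≡ (E.leaf-Adj e')))

  cost-bound : ∀ {a} → IsAlphaR G a → cost G f ≤ n ∸ branchCount G + a
  cost-bound (_ , maximal) = counting-bound cost+witnesses≤n length-partition (maximal specials specials-independent)
    where
    open Partition (partition (λ b y → Witness b y × y ∉ K) Exceptional
                              (λ w w' → Witness-injective (proj₁ w) (proj₁ w'))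
                              (filter⁺ (λ v → 3 ≤? deg G v) (allFin⁺ n))
                              (All-map classify (all-filter (λ v → 3 ≤? deg G v) (allFin n))))
    cost+witnesses≤n : cost G f + length witnesses ≤ n
    cost+witnesses≤n = subst (_≤ n) (trans (length-++ K) (cong (_+ length witnesses) length-K))
      (Unique-length≤ (++⁺ K-unique witnesses-unique
        λ (y∈K , y∈ws) → proj₂ (proj₂ (proj₂ (witnessing y∈ws))) y∈K))
    specials-independent : IndepInR G specials
    specials-independent = specials-unique , (λ _ b∈ → Exceptional⇒InR (proj₂ (special b∈))) ,
                  λ _ _ b∈ b'∈ → Exceptional-¬Adj (proj₂ (special b∈)) (proj₂ (special b'∈))

nth : ∀ {A : Set} → A → List A → ℕ → A
nth d []       _       = d
nth d (x ∷ xs) zero    = x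
nth d (x ∷ xs) (suc i) = nth d xs i

module _ {A : Set} (d : A) where

  nth-∈ : ∀ {xs i} → i < length xs → nth d xs i ∈ xs
  nth-∈ {x ∷ xs} {zero}  _         = here refl
  nth-∈ {x ∷ xs} {suc i} (s≤s i<n) = there (nth-∈ i<n)

  ∈⇒nth : ∀ {x xs} → x ∈ xs → ∃[ i ] (i < length xs × nth d xs i ≡ x)
  ∈⇒nth (here refl) = 0 , s≤s z≤n , refl
  ∈⇒nth (there x∈)  = let i , i<n , e = ∈⇒nth x∈ in suc i , s≤s i<n , e

  nth-injective : ∀ {xs} → Unique xs → ∀ {i j} → i < length xs → j < length xs →
                  nth d xs i ≡ nth d xs j → i ≡ j
  nth-injective (x∉xs ∷ u) {zero}  {zero}  _         _         _ = refl
  nth-injective (x∉xs ∷ u) {zero}  {suc j} _         (s≤s j<n) e =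
    ⊥-elim (All¬⇒¬Any x∉xs (subst (_∈ _) (sym e) (nth-∈ j<n)))
  nth-injective (x∉xs ∷ u) {suc i} {zero}  (s≤s i<n) _         e =
    ⊥-elim (All¬⇒¬Any x∉xs (subst (_∈ _) e (nth-∈ i<n)))
  nth-injective (x∉xs ∷ u) {suc i} {suc j} (s≤s i<n) (s≤s j<n) e = cong suc (nth-injective u i<n j<n e)

nth-Adj : ∀ {n} {G : Graph n} {u v xs} d → PathFrom G u v xs →
          ∀ {i} → suc i < length xs → Adj G (nth d xs i) (nth d xs (suc i))
nth-Adj d single                {_}     (s≤s ())
nth-Adj d (cons a single)       {zero}  _ = a
nth-Adj d (cons a (cons a' P))  {zero}  _ = a
nth-Adj d (cons a P)            {suc i} (s≤s i+1<n) = nth-Adj d P i+1<n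

theorem5p3 : (n : ℕ) (C : Graph n) → IsCaterpillar C →
    (a : ℕ) → IsAlphaR C a →
    (f : Fin n → ℕ) → IsBroadcast C f → BoundaryIndependent C f →
    cost C f ≤ n ∸ branchCount C + a
theorem5p3 n C ((connected , acyclic) , u , _ , xs , (path , unique) , _ , _ , dominating)
           a α f broadcast independent =
  Broadcast.cost-bound C acyclic p (length xs) (nth-Adj u path) (nth-injective u unique) spine-dominating
    connected f broadcast independent α
  where
  p = nth u xs
  spine-dominating : ∀ x → (∃[ i ] (i < length xs × p i ≡ x)) ⊎ (∃[ i ] (i < length xs × Adj C x (p i)))
  spine-dominating x with dominating x
  ... | inj₁ x∈xs = inj₁ (∈⇒nth u x∈xs)
  ... | inj₂ (y , y∈xs , x~y) with ∈⇒nth u y∈xs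
  ...   | i , i<n , refl = inj₂ (i , i<n , x~y)
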